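{- Let $\mu$ be a constant and define numbers $b_j(N;\mu)$ for $N\ge0$, $0\le j\le N$, by $b_0(0;\mu)=1$ and, for $N\ge1$: $b_0(N;\mu)=b_0(N-1;\mu)$, $b_N(N;\mu)=\mu N\,b_{N-1}(N-1;\mu)$, and $b_{i-1}(N;\mu)=i\,b_{i-1}(N-1;\mu)+\mu(i-1)\,b_{i-2}(N-1;\mu)$ for $2\le i\le N$. Then $b_0(N;\mu)=1$ for all $N\ge0$, and for every $N\ge1$ and $j=1,2,\ldots,N$, $$b_j(N;\mu)=j\mu\sum_{i=0}^{N-j}(j+1)^i\,b_{j-1}(N-i-1;\mu).$$
   Context: These numbers are the coefficients for which $F(t)=\frac{1}{e^t-\mu}$ satisfies $F^{(N)}=(-1)^N\sum_{i=1}^{N+1}b_{i-1}(N;\mu)F^i$. -}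

module Defs where

open import Level using (Level)
open import Data.Nat using (ℕ; zero; suc; _≟_; _<?_)
open import Relation.Nullary using (yes; no)
open import Algebra.Bundles using (CommutativeRing)

module _ {c ℓ : Level} (R : CommutativeRing c ℓ) where
  open CommutativeRing R hiding (zero)

  ι : ℕ → Carrier
  ι zero    = 0#
  ι (suc n) = 1# + ι n

  pow : Carrier → ℕ → Carrier
  pow x zero    = 1#
  pow x (suc n) = x * pow x n

  sumTo : ℕ → (ℕ → Carrier) → Carrier
  sumTo zero    f = f 0
  sumTo (suc n) f = sumTo n f + f (suc n)

  -- bCoef μ N j = b_j(N; μ)  for 0 ≤ j ≤ N ; defined as 0# outside this range
  bCoef : Carrier → ℕ → ℕ → Carrier
  bCoef μ zero    zero    = 1#
  bCoef μ zero    (suc j) = 0#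
  bCoef μ (suc N) zero    = bCoef μ N zero
  bCoef μ (suc N) (suc j) with suc j ≟ suc N | suc j <? suc N
  ... | yes _ | _     = μ * ι (suc N) * bCoef μ N j
  -- b_{i-1}(N) = i b_{i-1}(N-1) + μ (i-1) b_{i-2}(N-1),  i = j+2, 2 ≤ i ≤ N
  ... | no _  | yes _ = ι (suc (suc j)) * bCoef μ N (suc j) + μ * ι (suc j) * bCoef μ N j
  ... | no _  | no _  = 0#

module Submission where

-- Write x = j + 1 and c = j μ.  The recurrence defining b_j(N) for 1 ≤ j < N
-- reads  b_j(N) = x · b_j(N−1) + μ j · b_{j−1}(N−1),  and on the diagonal
-- b_j(j) = μ j · b_{j−1}(j−1).  Unrolling the first term of the recurrence
-- down to the diagonal gives
--     b_j(N) = c · Σ_{i=0}^{N−j} xⁱ · b_{j−1}(N−i−1),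
-- which is proved by induction on the offset d = N − j: for d = 0 it is the
-- diagonal rule, and the step peels off the i = 0 term of the sum and factors
-- x out of the remaining terms.

open import Defs
open import Level using (Level)
open import Data.Nat using (ℕ; zero; suc; _≤_; _<_; _∸_; _≟_; _<?_; s≤s)
import Data.Nat as ℕ
open import Data.Nat.Properties using (m∸n+n≡m; m≤n+m; <⇒≢)
open import Data.Product using (_×_; _,_)
open import Algebra.Bundles using (CommutativeRing)
open import Relation.Nullary using (yes; no; contradiction)
open import Relation.Binary.PropositionalEquality as P using (_≡_)
import Relation.Binary.Reasoning.Setoid as SetoidReasoning

module Sums {c ℓ : Level} (R : CommutativeRing c ℓ) where
  open CommutativeRing R hiding (zero)
  open SetoidReasoning setoid

  sumTo-cong : ∀ n {f g : ℕ → Carrier} → (∀ i → f i ≈ g i) → sumTo R n f ≈ sumTo R n g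
  sumTo-cong zero    f≈g = f≈g 0
  sumTo-cong (suc n) f≈g = +-cong (sumTo-cong n f≈g) (f≈g (suc n))

  sumTo-split-first : ∀ n (f : ℕ → Carrier) →
                      sumTo R (suc n) f ≈ f 0 + sumTo R n (λ i → f (suc i))
  sumTo-split-first zero    f = refl
  sumTo-split-first (suc n) f = begin
    sumTo R (suc n) f + f (suc (suc n))
      ≈⟨ +-congʳ (sumTo-split-first n f) ⟩
    (f 0 + sumTo R n (λ i → f (suc i))) + f (suc (suc n))
      ≈⟨ +-assoc _ _ _ ⟩
    f 0 + (sumTo R n (λ i → f (suc i)) + f (suc (suc n))) ∎

  sumTo-scale : ∀ n x (f : ℕ → Carrier) → sumTo R n (λ i → x * f i) ≈ x * sumTo R n f
  sumTo-scale zero    x f = refl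
  sumTo-scale (suc n) x f = trans (+-congʳ (sumTo-scale n x f)) (sym (distribˡ x _ _))

module ClosedForm {c ℓ : Level} (R : CommutativeRing c ℓ) (μ : CommutativeRing.Carrier R) where
  open CommutativeRing R hiding (zero)
  open SetoidReasoning setoid
  open Sums R

  b : ℕ → ℕ → Carrier
  b = bCoef R μ

  b-zero : ∀ N → b N 0 ≈ 1#
  b-zero zero    = refl
  b-zero (suc N) = b-zero N

  b-diagonal : ∀ k → b (suc k) (suc k) ≈ μ * ι R (suc k) * b k k
  b-diagonal k with suc k ≟ suc k | suc k <? suc k
  ... | yes _ | _ = refl
  ... | no k≢k | _ = contradiction P.refl k≢k

  strictly-below : ∀ k d → suc k < suc (suc (d ℕ.+ k))
  strictly-below k d = s≤s (s≤s (m≤n+m k d))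

  b-interior : ∀ k d → let N = suc (d ℕ.+ k) in
               b (suc N) (suc k) ≈ ι R (suc (suc k)) * b N (suc k) + μ * ι R (suc k) * b N k
  b-interior k d with suc k ≟ suc (suc (d ℕ.+ k)) | suc k <? suc (suc (d ℕ.+ k))
  ... | no _    | yes _  = refl
  ... | yes k≡N | _      = contradiction k≡N (<⇒≢ (strictly-below k d))
  ... | no _    | no k≮N = contradiction (strictly-below k d) k≮N

  -- The ring identity behind the induction step: with B = b_k(N) and
  -- S' = x·S the shifted tail of the sum,  x·(c·S) + μ i·B = c·(1·B + S')
  -- where c = i μ.
  factor-step : ∀ x i S S' B → S' ≈ x * S →
                x * ((i * μ) * S) + μ * i * B ≈ (i * μ) * (1# * B + S')
  factor-step x i S S' B S'≈xS = begin
    x * ((i * μ) * S) + μ * i * B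
      ≈⟨ +-cong (trans (sym (*-assoc _ _ _)) (trans (*-congʳ (*-comm x _)) (*-assoc _ _ _)))
                (*-congʳ (*-comm μ i)) ⟩
    (i * μ) * (x * S) + (i * μ) * B
      ≈⟨ +-comm _ _ ⟩
    (i * μ) * B + (i * μ) * (x * S)
      ≈⟨ sym (distribˡ _ _ _) ⟩
    (i * μ) * (B + x * S)
      ≈⟨ *-congˡ (+-cong (sym (*-identityˡ B)) (sym S'≈xS)) ⟩
    (i * μ) * (1# * B + S') ∎

  closed-form : ∀ k d →
    b (suc (d ℕ.+ k)) (suc k) ≈
      (ι R (suc k) * μ) * sumTo R d (λ i → pow R (ι R (suc (suc k))) i * b (suc (d ℕ.+ k) ∸ i ∸ 1) k)
  closed-form k zero = begin
    b (suc k) (suc k)              ≈⟨ b-diagonal k ⟩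
    μ * ι R (suc k) * b k k        ≈⟨ *-cong (*-comm μ _) (sym (*-identityˡ _)) ⟩
    (ι R (suc k) * μ) * (1# * b k k) ∎
  closed-form k (suc d) = begin
    b (suc N) (suc k)
      ≈⟨ b-interior k d ⟩
    x * b N (suc k) + μ * ι R (suc k) * b N k
      ≈⟨ +-congʳ (*-congˡ (closed-form k d)) ⟩
    x * ((ι R (suc k) * μ) * sumTo R d term) + μ * ι R (suc k) * b N k
      ≈⟨ factor-step x (ι R (suc k)) (sumTo R d term) _ _ tail≈x*sum ⟩
    (ι R (suc k) * μ) * (1# * b N k + sumTo R d (λ i → term′ (suc i)))
      ≈⟨ *-congˡ (sym (sumTo-split-first d term′)) ⟩
    (ι R (suc k) * μ) * sumTo R (suc d) term′ ∎
    where
    N = suc (d ℕ.+ k)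
    x = ι R (suc (suc k))
    term  = λ i → pow R x i * b (N ∸ i ∸ 1) k
    term′ = λ i → pow R x i * b (suc N ∸ i ∸ 1) k
    -- Dropping the i = 0 term and shifting, each remaining term is x times a term
    -- of the previous sum.
    tail≈x*sum : sumTo R d (λ i → term′ (suc i)) ≈ x * sumTo R d term
    tail≈x*sum = trans (sumTo-cong d (λ i → *-assoc _ _ _)) (sumTo-scale d x term)

  closed-form-≤ : ∀ M k → k ≤ M →
    b (suc M) (suc k) ≈
      (ι R (suc k) * μ) * sumTo R (M ∸ k) (λ i → pow R (ι R (suc (suc k))) i * b (suc M ∸ i ∸ 1) k)
  closed-form-≤ M k k≤M = P.subst
    (λ M′ → b (suc M′) (suc k) ≈
      (ι R (suc k) * μ) * sumTo R (M ∸ k) (λ i → pow R (ι R (suc (suc k))) i * b (suc M′ ∸ i ∸ 1) k))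
    (m∸n+n≡m k≤M) (closed-form k (M ∸ k))

mainTheorem8 : {c ℓ : Level} (R : CommutativeRing c ℓ) (μ : CommutativeRing.Carrier R) →
    ((N : ℕ) → CommutativeRing._≈_ R (bCoef R μ N 0) (CommutativeRing.1# R))
    × ((N j : ℕ) → 1 ≤ N → 1 ≤ j → j ≤ N →
        CommutativeRing._≈_ R (bCoef R μ N j)
          (CommutativeRing._*_ R (CommutativeRing._*_ R (ι R j) μ)
            (sumTo R (N ∸ j) (λ i → CommutativeRing._*_ R (pow R (ι R (suc j)) i) (bCoef R μ (N ∸ i ∸ 1) (j ∸ 1))))))
mainTheorem8 R μ = b-zero , λ { (suc M) (suc k) _ _ (s≤s k≤M) → closed-form-≤ M k k≤M }
  where open ClosedForm R μ
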